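{- For any non-empty string $S$, $|\mathcal{PS}_S| \leq (3|S|-1)/2$. Moreover, this bound is tight: for every odd integer $n \geq 5$ there exists a string $T$ of length $n$ such that $|\mathcal{PS}_T| = (3n-1)/2$.
   Context: For a string $S$ of length $n$ (over some alphabet) and $1 \le i \le j \le n$, $S[i..j]$ is the substring from position $i$ to position $j$, and $\#\mathit{occ}_S(w)$ is the number of positions $i$ with $S[i..i+|w|-1]=w$. A non-empty substring $w$ is unique if $\#\mathit{occ}_S(w)=1$ and repeating if $\#\mathit{occ}_S(w)\ge 2$; an interval $[i,j]$ is called unique/repeating according to $S[i..j]$. For intervals, $[s,t]\subset[i,j]$ means $i\le s$ and $t\le j$. For an interval $[s,t]$ with $1\le s\le t\le n$, an interval $[i,j]$ is a shortest unique substring (SUS) for $[s,t]$ if (1) $S[i..j]$ is unique, (2) $[s,t]\subset[i,j]$, and (3) $S[i'..j']$ is repeating for every $[i',j']$ with $[s,t]\subset[i',j']$ and $j'-i'<j-i$. For a position $p$, $\mathsf{SUS}_S(p)$ denotes the set of SUSs for $[p,p]$ (point SUSs for $p$), and $\mathcal{PS}_S=\bigcup_{p=1}^{n}\mathsf{SUS}_S(p)$ is the set of all point SUSs of $S$ (a set of intervals). -}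

module Defs where

open import Data.Nat using (ℕ; suc; _+_; _*_; _∸_; _≤_; _<_)
open import Data.List using (List; length; take; drop)
open import Data.Product using (Σ; _×_; _,_; ∃)
open import Relation.Binary.PropositionalEquality using (_≡_; _≢_)

-- Positions are 1-indexed, as in the paper.  A string is a List A;
-- |S| = length S.

-- S[i..j]  (meaningful for 1 ≤ i ≤ j ≤ |S|)
sub : {A : Set} → List A → ℕ → ℕ → List A
sub S i j = take (suc (j ∸ i)) (drop (i ∸ 1) S)

-- w occurs at position k of S:  S[k..k+|w|-1] = w  (with 1 ≤ k; since take
-- returns a shorter list when running past the end, this forces k+|w|-1 ≤ |S|
-- for non-empty w)
OccursAt : {A : Set} → List A → List A → ℕ → Set
OccursAt S w k = (1 ≤ k) × (take (length w) (drop (k ∸ 1) S) ≡ w)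

UniqueStr : {A : Set} → List A → List A → Set
UniqueStr S w = Σ ℕ λ k → OccursAt S w k × (∀ k′ → OccursAt S w k′ → k′ ≡ k)

RepeatingStr : {A : Set} → List A → List A → Set
RepeatingStr S w = Σ ℕ λ k → Σ ℕ λ k′ → (k ≢ k′) × OccursAt S w k × OccursAt S w k′

Interval : Set
Interval = ℕ × ℕ

UniqueInt : {A : Set} → List A → ℕ → ℕ → Set
UniqueInt S i j = UniqueStr S (sub S i j)

RepeatingInt : {A : Set} → List A → ℕ → ℕ → Set
RepeatingInt S i j = RepeatingStr S (sub S i j)

-- [i,j] is a SUS for [s,t] in S  (1 ≤ s ≤ t ≤ |S| assumed by the caller)
IsSUS : {A : Set} → List A → ℕ → ℕ → ℕ → ℕ → Set
IsSUS S s t i j =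
  (1 ≤ i) × (j ≤ length S) ×
  UniqueInt S i j ×
  (i ≤ s) × (t ≤ j) ×
  (∀ i′ j′ → 1 ≤ i′ → j′ ≤ length S → i′ ≤ s → t ≤ j′ →
     j′ ∸ i′ < j ∸ i → RepeatingInt S i′ j′)

-- [i,j] ∈ PS_S : [i,j] ∈ SUS_S(p) for some position p
PointSUS : {A : Set} → List A → Interval → Set
PointSUS S (i , j) = Σ ℕ λ p → (1 ≤ p) × (p ≤ length S) × IsSUS S p p i j

Odd : ℕ → Set
Odd n = ∃ λ k → n ≡ 1 + 2 * k

module Submission where

-- A point SUS [i,j] is a minimal unique substring (no proper
-- prefix or suffix unique), or a SUS for its right end whose prefix [i,j−1] is
-- unique (atEnd), or a SUS for its left end whose suffix [i+1,j] is unique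
-- (atStart).  Each kind gets two of three keys: the end j (minimal, atEnd), the
-- start i (minimal, atStart), and a pivot in [1,n−1] (j−1 for atEnd, i for
-- atStart).  Each key determines its interval: minimal and atEnd intervals are
-- the shortest unique intervals ending at j (dually for starts), and an atEnd
-- SUS [i,p+1] and an atStart SUS [p,j′] would undercut each other.  Pigeonhole
-- gives 2|PS_S| ≤ n + n + (n − 1).  Finding the kind needs excluded middle,
-- which is harmless since the goal is a decidable inequality.
--
-- Tightness.  For n = 2k + 1, T = 1 0 2 0 … 0 (k+1) has exactly the k + 1
-- letters at odd positions and the 2k intervals of length two as point SUSs.

open import Defs
open import Data.Nat using (ℕ; _+_; _*_; _∸_; _≤_)
open import Data.List using (List; length)
open import Data.List.Relation.Unary.All using (All; []; _∷_)
open import Data.List.Relation.Unary.Unique.Propositional using (Unique)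
open import Data.List.Membership.Propositional using (_∈_)
open import Data.Product using (Σ; _×_)
open import Function.Bundles using (_⇔_)
open import Relation.Binary.PropositionalEquality using (_≡_)

open import Data.Nat using (zero; suc; _<_; z≤n; s≤s; _≟_; _≤?_; _⊓_)
open import Data.Nat.Properties
open import Data.List using ([]; _∷_; take; drop; filter; map; mapMaybe; fromMaybe; applyUpTo; upTo; _++_)
open import Data.List.Properties using (length-take; length-drop; take-drop; take-take; drop-drop; filter-all; filter-accept; filter-reject; length-map; length-applyUpTo; length-++; length-upTo)
open import Data.List.Membership.Propositional.Properties using (∈-map⁺; ∈-map⁻; ∈-++⁺ˡ; ∈-++⁺ʳ; ∈-++⁻; ∈-upTo⁺; ∈-upTo⁻)
import Data.List.Relation.Unary.All as All
open import Data.List.Relation.Unary.All.Properties using (all-filter)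
import Data.List.Relation.Unary.All.Properties as All
open import Data.List.Relation.Unary.AllPairs using (AllPairs; []; _∷_)
import Data.List.Relation.Unary.AllPairs as AllPairs
import Data.List.Relation.Unary.AllPairs.Properties as AllPairs
import Data.List.Relation.Unary.Unique.Propositional.Properties as Unique
open import Data.Product using (_,_; proj₁; proj₂)
open import Data.Maybe using (Maybe; just; nothing)
open import Data.Maybe.Properties using (just-injective)
open import Data.Sum using (_⊎_; inj₁; inj₂)
open import Data.Empty using (⊥; ⊥-elim)
open import Function using (_∘_)
open import Function.Bundles using (mk⇔)
open import Relation.Nullary using (¬_; ¬?; yes; no)
open import Relation.Nullary.Decidable using (¬¬-excluded-middle; decidable-stable)
open import Relation.Nullary.Negation using (¬¬-Monad; ¬¬-map)
open import Data.Nat.Tactic.RingSolver using (solve-∀)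
open import Effect.Monad using (RawMonad)
open import Level using (0ℓ)
open import Relation.Binary using (tri<; tri≈; tri>)
open import Relation.Binary.PropositionalEquality using (_≢_; refl; sym; trans; cong; cong₂; subst; subst₂; module ≡-Reasoning)

∸-split : ∀ {i a b} → i ≤ a → a ≤ b → (a ∸ i) + (b ∸ a) ≡ b ∸ i
∸-split {zero} z≤n a≤b = m+[n∸m]≡n a≤b
∸-split {suc i} (s≤s i≤a) (s≤s a≤b) = ∸-split i≤a a≤b

-- Positions are 1-indexed; m − 1 is the 0-indexed position of m.
pred-below : ∀ {m n} → 1 ≤ m → m ≤ n → m ∸ 1 < n
pred-below {suc m} _ m<n = m<n

data Parity : ℕ → Set where
  even : ∀ t → Parity (t + t)
  odd  : ∀ t → Parity (suc (t + t))

parity : ∀ m → Parity m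
parity zero = even 0
parity (suc m) with parity m
... | even t = odd t
... | odd t  = subst Parity (cong suc (+-suc t t)) (even (suc t))

double-injective : ∀ {a b} → a + a ≡ b + b → a ≡ b
double-injective {a} {b} eq with <-cmp a b
... | tri< a<b _ _ = ⊥-elim (<⇒≢ (+-mono-< a<b a<b) eq)
... | tri≈ _ a≡b _ = a≡b
... | tri> _ _ b<a = ⊥-elim (<⇒≢ (+-mono-< b<a b<a) (sym eq))

double-cancel-≤ : ∀ {a b} → a + a ≤ b + b → a ≤ b
double-cancel-≤ {a} {b} le with a ≤? b
... | yes a≤b = a≤b
... | no a≰b  = ⊥-elim (<⇒≱ (+-mono-< (≰⇒> a≰b) (≰⇒> a≰b)) le)

double-cancel-< : ∀ {a b} → a + a < b + b → a < b
double-cancel-< {a} {b} lt with b ≤? a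
... | yes b≤a = ⊥-elim (<⇒≱ lt (+-mono-≤ b≤a b≤a))
... | no b≰a  = ≰⇒> b≰a

module _ {A : Set} where

  take-drop-take : ∀ d l m (xs : List A) → d + l ≤ m →
                   take l (drop d (take m xs)) ≡ take l (drop d xs)
  take-drop-take d l m xs d+l≤m = begin
    take l (drop d (take m xs))        ≡⟨ take-drop l d (take m xs) ⟩
    drop d (take (d + l) (take m xs))  ≡⟨ cong (drop d) (take-take (d + l) m xs) ⟩
    drop d (take ((d + l) ⊓ m) xs)     ≡⟨ cong (λ r → drop d (take r xs)) (m≤n⇒m⊓n≡m d+l≤m) ⟩
    drop d (take (d + l) xs)           ≡⟨ take-drop l d xs ⟨
    take l (drop d xs)                 ∎
    where open ≡-Reasoning

  occurs-factor : ∀ (S w w′ : List A) k u → OccursAt S w k →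
                  u + length w′ ≤ length w → take (length w′) (drop u w) ≡ w′ →
                  OccursAt S w′ (k + u)
  occurs-factor S w w′ k u (1≤k , occ) fits factor = ≤-trans 1≤k (m≤m+n k u) , (begin
    take (length w′) (drop (k + u ∸ 1) S)
      ≡⟨ cong (λ d → take (length w′) (drop d S)) (+-∸-comm u 1≤k) ⟩
    take (length w′) (drop (k ∸ 1 + u) S)
      ≡⟨ cong (take (length w′)) (drop-drop (k ∸ 1) u S) ⟨
    take (length w′) (drop u (drop (k ∸ 1) S))
      ≡⟨ take-drop-take u (length w′) (length w) (drop (k ∸ 1) S) fits ⟨
    take (length w′) (drop u (take (length w) (drop (k ∸ 1) S)))
      ≡⟨ cong (λ v → take (length w′) (drop u v)) occ ⟩
    take (length w′) (drop u w)
      ≡⟨ factor ⟩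
    w′ ∎)
    where open ≡-Reasoning

window-applyUpTo : ∀ {A : Set} (f : ℕ → A) {n d} → d < n → take 1 (drop d (applyUpTo f n)) ≡ f d ∷ []
window-applyUpTo f {suc n} {zero}  _         = refl
window-applyUpTo f {suc n} {suc d} (s≤s d<n) = window-applyUpTo (f ∘ suc) d<n

window-applyUpTo⁻ : ∀ {A : Set} (f : ℕ → A) n d {v} → take 1 (drop d (applyUpTo f n)) ≡ v ∷ [] → f d ≡ v
window-applyUpTo⁻ f zero    zero    ()
window-applyUpTo⁻ f zero    (suc d) ()
window-applyUpTo⁻ f (suc n) zero    refl = refl
window-applyUpTo⁻ f (suc n) (suc d) eq   = window-applyUpTo⁻ (f ∘ suc) n d eq

without : ℕ → List ℕ → List ℕ
without m = filter (λ x → ¬? (x ≟ m))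

length-without : ∀ m xs → Unique xs → length xs ≤ suc (length (without m xs))
length-without m [] [] = z≤n
length-without m (x ∷ xs) (x∉xs ∷ distinct) with x ≟ m
... | yes refl rewrite filter-reject (λ y → ¬? (y ≟ x)) {xs = xs} (λ x≢x → x≢x refl)
                   | filter-all (λ y → ¬? (y ≟ x)) (All.map (λ x≢y y≡x → x≢y (sym y≡x)) x∉xs) = ≤-refl
... | no x≢m   rewrite filter-accept (λ y → ¬? (y ≟ m)) {xs = xs} x≢m = s≤s (length-without m xs distinct)

distinct-below-length : ∀ m xs → Unique xs → All (_< m) xs → length xs ≤ m
distinct-below-length zero    []      _        _           = z≤n
distinct-below-length zero    (_ ∷ _) _        (() ∷ _)
distinct-below-length (suc m) xs      distinct below =
  ≤-trans (length-without m xs distinct) (s≤s (distinct-below-length m (without m xs)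
    (Unique.filter⁺ (λ y → ¬? (y ≟ m)) distinct)
    (All.zipWith (λ (y<1+m , y≢m) → ≤∧≢⇒< (≤-pred y<1+m) y≢m)
                 (All.filter⁺ (λ y → ¬? (y ≟ m)) below , all-filter (λ y → ¬? (y ≟ m)) xs))))

module _ {B : Set} (key : B → Maybe ℕ) where

  SharedKey : B → B → Set
  SharedKey x y = Σ ℕ λ k → key x ≡ just k × key y ≡ just k

  length-mapMaybe-∷ : ∀ x xs → length (mapMaybe key (x ∷ xs)) ≡ length (fromMaybe (key x)) + length (mapMaybe key xs)
  length-mapMaybe-∷ x xs with key x
  ... | just _  = refl
  ... | nothing = refl

  keys-distinct : ∀ {xs} → AllPairs (λ x y → ¬ SharedKey x y) xs → Unique (mapMaybe key xs)
  keys-distinct {[]} [] = []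
  keys-distinct {x ∷ xs} (apart ∷ rest) with key x
  ... | nothing = keys-distinct rest
  ... | just k  = fresh (All.map (λ x-y {k′} ky k≡k′ → x-y (k′ , cong just k≡k′ , ky)) apart)
                  ∷ keys-distinct rest
    where
    fresh : ∀ {ys} → All (λ y → ∀ {k′} → key y ≡ just k′ → k ≢ k′) ys → All (k ≢_) (mapMaybe key ys)
    fresh {[]} [] = []
    fresh {y ∷ ys} (x-y ∷ x-ys) with key y
    ... | nothing = fresh x-ys
    ... | just k′ = x-y refl ∷ fresh x-ys

  keys-below : ∀ {m} → (∀ x {k} → key x ≡ just k → k < m) → ∀ xs → All (_< m) (mapMaybe key xs)
  keys-below below [] = []
  keys-below below (x ∷ xs) with key x in kx
  ... | nothing = keys-below below xs
  ... | just k  = below x kx ∷ keys-below below xs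

  keyed-entries-bound : ∀ {m} xs → AllPairs (λ x y → ¬ SharedKey x y) xs →
                        (∀ x {k} → key x ≡ just k → k < m) → length (mapMaybe key xs) ≤ m
  keyed-entries-bound {m} xs apart below = distinct-below-length m _ (keys-distinct apart) (keys-below below xs)

module _ {A : Set} (S : List A) where

  length-sub : ∀ {i j} → 1 ≤ i → i ≤ j → j ≤ length S → length (sub S i j) ≡ suc (j ∸ i)
  length-sub {suc i} {suc j} _ (s≤s i≤j) j<|S| = begin
    length (take (suc (j ∸ i)) (drop i S))  ≡⟨ length-take (suc (j ∸ i)) (drop i S) ⟩
    suc (j ∸ i) ⊓ length (drop i S)         ≡⟨ cong (suc (j ∸ i) ⊓_) (length-drop i S) ⟩
    suc (j ∸ i) ⊓ (length S ∸ i)            ≡⟨ m≤n⇒m⊓n≡m fits ⟩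
    suc (j ∸ i)                             ∎
    where
    open ≡-Reasoning
    fits : suc (j ∸ i) ≤ length S ∸ i
    fits = subst (_≤ length S ∸ i) (+-∸-assoc 1 i≤j) (∸-monoˡ-≤ i j<|S|)

  sub-occurs : ∀ {i j} → 1 ≤ i → i ≤ j → j ≤ length S → OccursAt S (sub S i j) i
  sub-occurs {i} {j} 1≤i i≤j j≤|S| = 1≤i , subst (λ l → take l (drop (i ∸ 1) S) ≡ sub S i j)
                                                 (sym (length-sub 1≤i i≤j j≤|S|)) refl

  sub-factor : ∀ {i a b j} → 1 ≤ i → i ≤ a → a ≤ b → b ≤ j → j ≤ length S →
               (a ∸ i + length (sub S a b) ≤ length (sub S i j)) ×
               (take (length (sub S a b)) (drop (a ∸ i) (sub S i j)) ≡ sub S a b)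
  sub-factor {i} {a} {b} {j} 1≤i i≤a a≤b b≤j j≤|S|
    rewrite length-sub 1≤i (≤-trans i≤a (≤-trans a≤b b≤j)) j≤|S|
          | length-sub (≤-trans 1≤i i≤a) a≤b (≤-trans b≤j j≤|S|) = fits , factor
    where
    fits : a ∸ i + suc (b ∸ a) ≤ suc (j ∸ i)
    fits = begin
      a ∸ i + suc (b ∸ a)   ≡⟨ +-suc (a ∸ i) (b ∸ a) ⟩
      suc (a ∸ i + (b ∸ a)) ≡⟨ cong suc (∸-split i≤a a≤b) ⟩
      suc (b ∸ i)           ≤⟨ s≤s (∸-monoˡ-≤ i b≤j) ⟩
      suc (j ∸ i)           ∎
      where open ≤-Reasoning
    factor : take (suc (b ∸ a)) (drop (a ∸ i) (sub S i j)) ≡ sub S a b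
    factor = begin
      take (suc (b ∸ a)) (drop (a ∸ i) (take (suc (j ∸ i)) (drop (i ∸ 1) S)))
        ≡⟨ take-drop-take (a ∸ i) (suc (b ∸ a)) (suc (j ∸ i)) (drop (i ∸ 1) S) fits ⟩
      take (suc (b ∸ a)) (drop (a ∸ i) (drop (i ∸ 1) S))
        ≡⟨ cong (take (suc (b ∸ a))) (drop-drop (i ∸ 1) (a ∸ i) S) ⟩
      take (suc (b ∸ a)) (drop (i ∸ 1 + (a ∸ i)) S)
        ≡⟨ cong (λ d → take (suc (b ∸ a)) (drop d S)) (∸-split 1≤i i≤a) ⟩
      sub S a b ∎
      where open ≡-Reasoning

  -- Uniqueness is inherited by superintervals: if [a,b] ⊂ [i,j] and S[a..b]
  -- is unique, so is S[i..j] (each occurrence of S[i..j] carries one of S[a..b]).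
  unique-extend : ∀ {i a b j} → UniqueInt S a b → 1 ≤ i → i ≤ a → a ≤ b → b ≤ j → j ≤ length S →
                  UniqueInt S i j
  unique-extend {i} {a} {b} {j} (k₀ , _ , only) 1≤i i≤a a≤b b≤j j≤|S| =
    i , sub-occurs 1≤i (≤-trans i≤a (≤-trans a≤b b≤j)) j≤|S| , at-i
    where
    at-i : ∀ k → OccursAt S (sub S i j) k → k ≡ i
    at-i k occ = +-cancelʳ-≡ (a ∸ i) k i (begin
      k + (a ∸ i)  ≡⟨ only (k + (a ∸ i)) (occurs-factor S (sub S i j) (sub S a b) k (a ∸ i) occ fits factor) ⟩
      k₀           ≡⟨ only a (sub-occurs (≤-trans 1≤i i≤a) a≤b (≤-trans b≤j j≤|S|)) ⟨
      a            ≡⟨ m+[n∸m]≡n i≤a ⟨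
      i + (a ∸ i)  ∎)
      where
      open ≡-Reasoning
      fits : a ∸ i + length (sub S a b) ≤ length (sub S i j)
      fits = proj₁ (sub-factor 1≤i i≤a a≤b b≤j j≤|S|)
      factor : take (length (sub S a b)) (drop (a ∸ i) (sub S i j)) ≡ sub S a b
      factor = proj₂ (sub-factor 1≤i i≤a a≤b b≤j j≤|S|)

unique-not-repeating : ∀ {A : Set} {S : List A} {i j} → UniqueInt S i j → ¬ RepeatingInt S i j
unique-not-repeating (_ , _ , only) (k , k′ , k≢k′ , occ , occ′) = k≢k′ (trans (only k occ) (sym (only k′ occ′)))

proper-subinterval-shorter : ∀ {i i′ j′ j} → i ≤ i′ → i′ ≤ j′ → j′ ≤ j → i < i′ ⊎ j′ < j →
                             j′ ∸ i′ < j ∸ i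
proper-subinterval-shorter {i} i≤i′ i′≤j′ j′≤j (inj₁ i<i′) = <-≤-trans (∸-monoʳ-< i<i′ i′≤j′) (∸-monoˡ-≤ i j′≤j)
proper-subinterval-shorter {j′ = j′} i≤i′ i′≤j′ j′≤j (inj₂ j′<j) =
  ≤-<-trans (∸-monoʳ-≤ j′ i≤i′) (∸-monoˡ-< j′<j (≤-trans i≤i′ i′≤j′))

module _ {A : Set} (S : List A) where

  sus-minimal : ∀ {p i j i′ j′} → IsSUS S p p i j → UniqueInt S i′ j′ →
                1 ≤ i′ → j′ ≤ length S → i′ ≤ p → p ≤ j′ → ¬ (j′ ∸ i′ < j ∸ i)
  sus-minimal {i′ = i′} {j′} (_ , _ , _ , _ , _ , shorter-repeats) U′ 1≤i′ j′≤|S| i′≤p p≤j′ shorter =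
    unique-not-repeating {i = i′} {j′} U′ (shorter-repeats _ _ 1≤i′ j′≤|S| i′≤p p≤j′ shorter)

  sus-no-unique-subinterval : ∀ {p i j i′ j′} → IsSUS S p p i j → UniqueInt S i′ j′ →
                              i ≤ i′ → i′ ≤ p → p ≤ j′ → j′ ≤ j → i < i′ ⊎ j′ < j → ⊥
  sus-no-unique-subinterval sus@(1≤i , j≤|S| , _) U′ i≤i′ i′≤p p≤j′ j′≤j proper =
    sus-minimal sus U′ (≤-trans 1≤i i≤i′) (≤-trans j′≤j j≤|S|) i′≤p p≤j′
      (proper-subinterval-shorter i≤i′ (≤-trans i′≤p p≤j′) j′≤j proper)

  sus-forced : ∀ {p i j i′ j′} → IsSUS S p p i j → UniqueInt S i′ j′ →
               i ≤ i′ → i′ ≤ p → p ≤ j′ → j′ ≤ j → (i , j) ≡ (i′ , j′)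
  sus-forced sus U′ i≤i′ i′≤p p≤j′ j′≤j with m≤n⇒m<n∨m≡n i≤i′ | m≤n⇒m<n∨m≡n j′≤j
  ... | inj₁ i<i′ | _        = ⊥-elim (sus-no-unique-subinterval sus U′ i≤i′ i′≤p p≤j′ j′≤j (inj₁ i<i′))
  ... | inj₂ _    | inj₁ j′<j = ⊥-elim (sus-no-unique-subinterval sus U′ i≤i′ i′≤p p≤j′ j′≤j (inj₂ j′<j))
  ... | inj₂ refl | inj₂ refl = refl

  unique-letter-sus : ∀ {p} → 1 ≤ p → p ≤ length S → UniqueInt S p p → IsSUS S p p p p
  unique-letter-sus {p} 1≤p p≤|S| U = 1≤p , p≤|S| , U , ≤-refl , ≤-refl ,
    λ i′ j′ _ _ _ _ shorter → ⊥-elim (n≮0 (subst (j′ ∸ i′ <_) (n∸n≡0 p) shorter))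

  -- If the letter at p repeats, a unique interval [i,j] ∋ p with j − i = 1 is a SUS
  -- for p: the only shorter interval around p is [p,p].
  length-two-sus : ∀ {p i j} → RepeatingInt S p p → UniqueInt S i j → 1 ≤ i → j ≤ length S →
                   i ≤ p → p ≤ j → j ∸ i ≡ 1 → IsSUS S p p i j
  length-two-sus {p} {i} {j} R U 1≤i j≤|S| i≤p p≤j j∸i≡1 = 1≤i , j≤|S| , U , i≤p , p≤j , only-letter
    where
    only-letter : ∀ i′ j′ → 1 ≤ i′ → j′ ≤ length S → i′ ≤ p → p ≤ j′ → j′ ∸ i′ < j ∸ i → RepeatingInt S i′ j′
    only-letter i′ j′ _ _ i′≤p p≤j′ shorter = subst₂ (RepeatingInt S) p≡i′ p≡j′ R
      where
      j′≤i′ : j′ ≤ i′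
      j′≤i′ = m∸n≡0⇒m≤n (n<1⇒n≡0 (subst (j′ ∸ i′ <_) j∸i≡1 shorter))
      p≡i′ : p ≡ i′
      p≡i′ = sym (≤-antisym i′≤p (≤-trans p≤j′ j′≤i′))
      p≡j′ : p ≡ j′
      p≡j′ = sym (≤-antisym (≤-trans j′≤i′ i′≤p) p≤j′)

module _ {A : Set} (S : List A) where

  NoUniqueSuffix : ℕ → ℕ → Set
  NoUniqueSuffix i j = ∀ i′ → i < i′ → i′ ≤ j → ¬ UniqueInt S i′ j

  NoUniquePrefix : ℕ → ℕ → Set
  NoUniquePrefix i j = ∀ j′ → i ≤ j′ → j′ < j → ¬ UniqueInt S i j′

  -- By unique-extend it suffices to check the longest proper suffix / prefix.
  no-unique-suffix : ∀ {i j} → j ≤ length S → (i < j → ¬ UniqueInt S (suc i) j) → NoUniqueSuffix i j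
  no-unique-suffix j≤|S| longest i′ i<i′ i′≤j U′ =
    longest (<-≤-trans i<i′ i′≤j) (unique-extend S U′ (s≤s z≤n) i<i′ i′≤j ≤-refl j≤|S|)

  no-unique-prefix : ∀ {i j} → 1 ≤ i → j ≤ length S → (i < j → ¬ UniqueInt S i (j ∸ 1)) → NoUniquePrefix i j
  no-unique-prefix {j = j} 1≤i j≤|S| longest j′ i≤j′ j′<j U′ =
    longest (≤-<-trans i≤j′ j′<j) (unique-extend S U′ 1≤i ≤-refl i≤j′ (<⇒≤pred j′<j) (≤-trans (m∸n≤m j 1) j≤|S|))

  ShortestEndingAt : Interval → Set
  ShortestEndingAt (i , j) = 1 ≤ i × i ≤ j × j ≤ length S × UniqueInt S i j × NoUniqueSuffix i j

  ShortestStartingAt : Interval → Set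
  ShortestStartingAt (i , j) = 1 ≤ i × i ≤ j × j ≤ length S × UniqueInt S i j × NoUniquePrefix i j

  ending-at-unique : ∀ {i i′ j} → ShortestEndingAt (i , j) → ShortestEndingAt (i′ , j) → i ≡ i′
  ending-at-unique {i} {i′} (_ , i≤j , _ , U , none) (_ , i′≤j , _ , U′ , none′) with <-cmp i i′
  ... | tri< i<i′ _ _ = ⊥-elim (none i′ i<i′ i′≤j U′)
  ... | tri≈ _ i≡i′ _ = i≡i′
  ... | tri> _ _ i′<i = ⊥-elim (none′ i i′<i i≤j U)

  starting-at-unique : ∀ {i j j′} → ShortestStartingAt (i , j) → ShortestStartingAt (i , j′) → j ≡ j′
  starting-at-unique {j = j} {j′} (_ , i≤j , _ , U , none) (_ , i≤j′ , _ , U′ , none′) with <-cmp j j′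
  ... | tri< j<j′ _ _ = ⊥-elim (none′ j i≤j j<j′ U)
  ... | tri≈ _ j≡j′ _ = j≡j′
  ... | tri> _ _ j′<j = ⊥-elim (none j′ i≤j′ j′<j U′)

  sus-at-end-shortest : ∀ {i j} → IsSUS S j j i j → ShortestEndingAt (i , j)
  sus-at-end-shortest sus@(1≤i , j≤|S| , U , i≤j , _) = 1≤i , i≤j , j≤|S| , U ,
    λ i′ i<i′ i′≤j U′ → sus-no-unique-subinterval S sus U′ (<⇒≤ i<i′) i′≤j ≤-refl ≤-refl (inj₁ i<i′)

  sus-at-start-shortest : ∀ {i j} → IsSUS S i i i j → ShortestStartingAt (i , j)
  sus-at-start-shortest sus@(1≤i , j≤|S| , U , _ , i≤j , _) = 1≤i , i≤j , j≤|S| , U ,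
    λ j′ i≤j′ j′<j U′ → sus-no-unique-subinterval S sus U′ ≤-refl ≤-refl i≤j′ (<⇒≤ j′<j) (inj₂ j′<j)

data Kind : Set where
  minimal : Kind
  atEnd   : Kind
  atStart : Kind

HasKind : {A : Set} → List A → Interval → Kind → Set
HasKind S (i , j) minimal = 1 ≤ i × i ≤ j × j ≤ length S × UniqueInt S i j ×
                            NoUniquePrefix S i j × NoUniqueSuffix S i j
HasKind S (i , j) atEnd   = i < j × UniqueInt S i (j ∸ 1) × IsSUS S j j i j
HasKind S (i , j) atStart = i < j × UniqueInt S (suc i) j × IsSUS S i i i j

KindedSUS : {A : Set} → List A → Set
KindedSUS S = Σ Interval λ I → Σ Kind (HasKind S I)

module _ {A : Set} (S : List A) where
  open RawMonad (¬¬-Monad {a = 0ℓ})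

  -- Every point SUS has one of the three kinds.  Deciding which needs
  -- excluded middle for uniqueness, hence the double negation.
  classify : ∀ {I} → PointSUS S I → ¬ ¬ Σ Kind (HasKind S I)
  classify {i , j} (p , _ , _ , sus@(1≤i , j≤|S| , U , i≤p , p≤j , _)) with i <? j
  ... | no i≮j = pure (minimal , 1≤i , i≤j , j≤|S| , U ,
                       no-unique-prefix S 1≤i j≤|S| (λ i<j → ⊥-elim (i≮j i<j)) ,
                       no-unique-suffix S j≤|S| (λ i<j → ⊥-elim (i≮j i<j)))
    where
    i≤j : i ≤ j
    i≤j = ≤-trans i≤p p≤j
  ... | yes i<j = ¬¬-excluded-middle {A = UniqueInt S (suc i) j} >>= λ where
      (yes U-suffix) → pure (atStart , i<j , U-suffix , subst (λ q → IsSUS S q q i j) (point-at-start U-suffix) sus)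
      (no ¬U-suffix) → ¬¬-excluded-middle {A = UniqueInt S i (j ∸ 1)} >>= λ where
        (yes U-prefix) → pure (atEnd , i<j , U-prefix , subst (λ q → IsSUS S q q i j) (point-at-end U-prefix) sus)
        (no ¬U-prefix) → pure (minimal , 1≤i , <⇒≤ i<j , j≤|S| , U ,
                               no-unique-prefix S 1≤i j≤|S| (λ _ → ¬U-prefix) ,
                               no-unique-suffix S j≤|S| (λ _ → ¬U-suffix))
    where
    -- A unique proper suffix (prefix) must not contain p, so p is the left (right) end.
    point-at-start : UniqueInt S (suc i) j → p ≡ i
    point-at-start U-suffix with p ≤? i
    ... | yes p≤i = ≤-antisym p≤i i≤p
    ... | no p≰i  = ⊥-elim (sus-no-unique-subinterval S sus U-suffix (n≤1+n i) (≰⇒> p≰i) p≤j ≤-refl (inj₁ ≤-refl))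
    point-at-end : UniqueInt S i (j ∸ 1) → p ≡ j
    point-at-end U-prefix with j ≤? p
    ... | yes j≤p = ≤-antisym p≤j j≤p
    ... | no j≰p  = ⊥-elim (sus-no-unique-subinterval S sus U-prefix ≤-refl i≤p (<⇒≤pred (≰⇒> j≰p))
                              (m∸n≤m j 1) (inj₂ (pred-below (≤-trans (s≤s z≤n) i<j) ≤-refl)))

  classify-all : ∀ {L} → All (PointSUS S) L → ¬ ¬ Σ (List (KindedSUS S)) λ X → map proj₁ X ≡ L
  classify-all [] = pure ([] , refl)
  classify-all {I ∷ L} (sus ∷ suss) = classify sus >>= λ k → classify-all suss >>= λ where
    (X , refl) → pure ((I , k) ∷ X , refl)

-- Each kinded SUS receives exactly two of three keys (0-indexed positions):
-- the end key j−1 (minimal, atEnd), the start key i−1 (minimal, atStart), and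
-- the pivot key (atEnd: j−2, atStart: i−1), which lies below |S| − 1.
endKey startKey pivotKey : {A : Set} {S : List A} → KindedSUS S → Maybe ℕ
endKey ((i , j) , minimal , _) = just (j ∸ 1)
endKey ((i , j) , atEnd   , _) = just (j ∸ 1)
endKey ((i , j) , atStart , _) = nothing
startKey ((i , j) , minimal , _) = just (i ∸ 1)
startKey ((i , j) , atEnd   , _) = nothing
startKey ((i , j) , atStart , _) = just (i ∸ 1)
pivotKey ((i , j) , minimal , _) = nothing
pivotKey ((i , j) , atEnd   , _) = just (j ∸ 2)
pivotKey ((i , j) , atStart , _) = just (i ∸ 1)

module _ {A : Set} (S : List A) where

  KeyInjective : (KindedSUS S → Maybe ℕ) → Set
  KeyInjective key = ∀ x y {k} → key x ≡ just k → key y ≡ just k → proj₁ x ≡ proj₁ y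

  KeyBelow : (KindedSUS S → Maybe ℕ) → ℕ → Set
  KeyBelow key m = ∀ x {k} → key x ≡ just k → k < m

  -- The end key is carried by shortest unique intervals ending at j, so it determines them.
  end-carrier : ∀ (x : KindedSUS S) {k} → endKey x ≡ just k → ShortestEndingAt S (proj₁ x) × (proj₂ (proj₁ x) ∸ 1 ≡ k)
  end-carrier (_ , minimal , (1≤i , i≤j , j≤|S| , U , _ , none)) refl = (1≤i , i≤j , j≤|S| , U , none) , refl
  end-carrier (_ , atEnd , (_ , _ , sus)) refl = sus-at-end-shortest S sus , refl
  end-carrier (_ , atStart , _) ()

  endKey-injective : KeyInjective endKey
  endKey-injective x y kx ky with end-carrier x kx | end-carrier y ky
  ... | cx@(1≤i , i≤j , _) , refl | cy@(1≤i′ , i′≤j′ , _) , same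
    with refl ← ∸-cancelʳ-≡ (≤-trans 1≤i i≤j) (≤-trans 1≤i′ i′≤j′) (sym same)
    = cong (_, _) (ending-at-unique S cx cy)

  endKey-below : KeyBelow endKey (length S)
  endKey-below x kx with end-carrier x kx
  ... | (1≤i , i≤j , j≤|S| , _) , refl = pred-below (≤-trans 1≤i i≤j) j≤|S|

  -- Symmetrically, the start key is carried by shortest unique intervals starting at i.
  start-carrier : ∀ (x : KindedSUS S) {k} → startKey x ≡ just k → ShortestStartingAt S (proj₁ x) × (proj₁ (proj₁ x) ∸ 1 ≡ k)
  start-carrier (_ , minimal , (1≤i , i≤j , j≤|S| , U , none , _)) refl = (1≤i , i≤j , j≤|S| , U , none) , refl
  start-carrier (_ , atStart , (_ , _ , sus)) refl = sus-at-start-shortest S sus , refl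
  start-carrier (_ , atEnd , _) ()

  startKey-injective : KeyInjective startKey
  startKey-injective x y kx ky with start-carrier x kx | start-carrier y ky
  ... | cx@(1≤i , _) , refl | cy@(1≤i′ , _) , same
    with refl ← ∸-cancelʳ-≡ 1≤i 1≤i′ (sym same)
    = cong (_ ,_) (starting-at-unique S cx cy)

  startKey-below : KeyBelow startKey (length S)
  startKey-below x kx with start-carrier x kx
  ... | (1≤i , i≤j , j≤|S| , _) , refl = pred-below 1≤i (≤-trans i≤j j≤|S|)

  atEnd-2≤ : ∀ {i j} → HasKind S (i , j) atEnd → 2 ≤ j
  atEnd-2≤ (i<j , _ , (1≤i , _)) = ≤-trans (s≤s 1≤i) i<j

  -- An atEnd SUS [i,p+1] and an atStart SUS [p,j′] cannot coexist: the
  -- shorter of their unique parts [i,p] and [p+1,j′] would undercut the other.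
  no-pivot-clash : ∀ {i p j′} → HasKind S (i , suc p) atEnd → HasKind S (p , j′) atStart → ⊥
  no-pivot-clash {i} {p} {j′} (i≤p , U-left , sus-end@(1≤i , p<|S| , _))
                              (p<j′ , U-right , sus-start@(_ , j′≤|S| , _))
    with ≤-total (p ∸ i) (j′ ∸ suc p)
  ... | inj₁ left-shorter = sus-minimal S sus-start U-left 1≤i (<⇒≤ p<|S|) (≤-pred i≤p) ≤-refl
                              (subst (p ∸ i <_) (sym (+-∸-assoc 1 p<j′)) (s≤s left-shorter))
  ... | inj₂ right-shorter = sus-minimal S sus-end U-right (s≤s z≤n) j′≤|S| ≤-refl p<j′
                               (subst (j′ ∸ suc p <_) (sym (+-∸-assoc 1 (≤-pred i≤p))) (s≤s right-shorter))

  pivotKey-injective : KeyInjective pivotKey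
  pivotKey-injective (_ , minimal , _) _ () _
  pivotKey-injective (_ , atEnd , _) (_ , minimal , _) _ ()
  pivotKey-injective (_ , atStart , _) (_ , minimal , _) _ ()
  pivotKey-injective x@(_ , atEnd , e) y@(_ , atEnd , e′) refl same
    with refl ← ∸-cancelʳ-≡ (atEnd-2≤ e) (atEnd-2≤ e′) (just-injective (sym same))
    = endKey-injective x y refl refl
  pivotKey-injective x@(_ , atStart , (_ , _ , (1≤i , _))) y@(_ , atStart , (_ , _ , (1≤i′ , _))) refl same
    with refl ← ∸-cancelʳ-≡ 1≤i 1≤i′ (just-injective (sym same))
    = startKey-injective x y refl refl
  pivotKey-injective (_ , atEnd , e) (_ , atStart , e′@(_ , _ , (1≤i′ , _))) refl same
    with refl ← ∸-cancelʳ-≡ (atEnd-2≤ e) (s≤s 1≤i′) (just-injective (sym same))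
    = ⊥-elim (no-pivot-clash e e′)
  pivotKey-injective (_ , atStart , e@(_ , _ , (1≤i , _))) (_ , atEnd , e′) refl same
    with refl ← ∸-cancelʳ-≡ (atEnd-2≤ e′) (s≤s 1≤i) (just-injective same)
    = ⊥-elim (no-pivot-clash e′ e)

  pivotKey-below : KeyBelow pivotKey (length S ∸ 1)
  pivotKey-below (_ , minimal , _) ()
  pivotKey-below ((i , j) , atEnd , e@(_ , _ , (_ , j≤|S| , _))) refl =
    <-≤-trans (∸-monoʳ-< ≤-refl (atEnd-2≤ e)) (∸-monoˡ-≤ 1 j≤|S|)
  pivotKey-below ((i , j) , atStart , (i<j , _ , (1≤i , j≤|S| , _))) refl =
    ∸-monoˡ-< (<-≤-trans i<j j≤|S|) 1≤i

two-keys : ∀ {A : Set} {S : List A} (x : KindedSUS S) →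
           length (fromMaybe (endKey x)) + length (fromMaybe (startKey x)) + length (fromMaybe (pivotKey x)) ≡ 2
two-keys (_ , minimal , _) = refl
two-keys (_ , atEnd   , _) = refl
two-keys (_ , atStart , _) = refl

key-total : ∀ {A : Set} {S : List A} (X : List (KindedSUS S)) →
            length (mapMaybe endKey X) + length (mapMaybe startKey X) + length (mapMaybe pivotKey X) ≡ 2 * length X
key-total [] = refl
key-total (x ∷ X) = begin
  length (mapMaybe endKey (x ∷ X)) + length (mapMaybe startKey (x ∷ X)) + length (mapMaybe pivotKey (x ∷ X))
    ≡⟨ cong₂ _+_ (cong₂ _+_ (length-mapMaybe-∷ endKey x X) (length-mapMaybe-∷ startKey x X))
                 (length-mapMaybe-∷ pivotKey x X) ⟩
  (e₁ + e) + (s₁ + s) + (p₁ + p)  ≡⟨ interchange e₁ e s₁ s p₁ p ⟩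
  (e₁ + s₁ + p₁) + (e + s + p)    ≡⟨ cong₂ _+_ (two-keys x) (key-total X) ⟩
  2 + 2 * length X                ≡⟨ *-suc 2 (length X) ⟨
  2 * length (x ∷ X)              ∎
  where
  open ≡-Reasoning
  e₁ s₁ p₁ e s p : ℕ
  e₁ = length (fromMaybe (endKey x))
  s₁ = length (fromMaybe (startKey x))
  p₁ = length (fromMaybe (pivotKey x))
  e = length (mapMaybe endKey X)
  s = length (mapMaybe startKey X)
  p = length (mapMaybe pivotKey X)
  interchange : ∀ a b c d f g → (a + b) + (c + d) + (f + g) ≡ (a + c + f) + (b + d + g)
  interchange = solve-∀

module _ {A : Set} (S : List A) where

  -- The bound for classified point SUSs: 2|X| is the number of keys, and
  -- there are at most n end keys, n start keys and n − 1 pivot keys.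
  kinded-bound : 1 ≤ length S → (X : List (KindedSUS S)) → Unique (map proj₁ X) →
                 2 * length (map proj₁ X) ≤ 3 * length S ∸ 1
  kinded-bound 1≤n X distinct = begin
    2 * length (map proj₁ X)  ≡⟨ cong (2 *_) (length-map proj₁ X) ⟩
    2 * length X              ≡⟨ key-total X ⟨
    length (mapMaybe endKey X) + length (mapMaybe startKey X) + length (mapMaybe pivotKey X)
      ≤⟨ +-mono-≤ (+-mono-≤ (count endKey (endKey-injective S) (endKey-below S))
                            (count startKey (startKey-injective S) (startKey-below S)))
                  (count pivotKey (pivotKey-injective S) (pivotKey-below S)) ⟩
    n + n + (n ∸ 1)           ≡⟨ +-∸-assoc (n + n) 1≤n ⟨
    n + n + n ∸ 1             ≡⟨ cong (_∸ 1) (triple n) ⟩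
    3 * n ∸ 1                 ∎
    where
    open ≤-Reasoning
    n : ℕ
    n = length S
    apart : AllPairs (λ x y → proj₁ x ≢ proj₁ y) X
    apart = AllPairs.map⁻ distinct
    count : ∀ {m} key → KeyInjective S key → KeyBelow S key m → length (mapMaybe key X) ≤ m
    count key injective below =
      keyed-entries-bound key X (AllPairs.map (λ x≢y (_ , kx , ky) → x≢y (injective _ _ kx ky)) apart) below
    triple : ∀ n → n + n + n ≡ 3 * n
    triple = solve-∀

-- First half of the theorem: |PS_S| ≤ (3|S| − 1)/2.  The target is a decidable
-- inequality, so it may be proved under the double negation of classify-all.
point-sus-upper-bound : (A : Set) (S : List A) → 1 ≤ length S →
                        (L : List Interval) → Unique L → All (PointSUS S) L →
                        2 * length L ≤ 3 * length S ∸ 1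
point-sus-upper-bound A S 1≤n L distinct suss =
  decidable-stable (2 * length L ≤? 3 * length S ∸ 1)
    (¬¬-map (λ { (X , refl) → kinded-bound S 1≤n X distinct }) (classify-all S suss))

-- The letters of the tight example 1 0 2 0 3 0 …: letter (t + t) = t + 1 and
-- letter (1 + t + t) = 0.  (zigzag c counts up from c on even positions.)
zigzag : ℕ → ℕ → ℕ
zigzag c zero          = c
zigzag c (suc zero)    = 0
zigzag c (suc (suc m)) = zigzag (suc c) m

letter : ℕ → ℕ
letter = zigzag 1

zigzag-even : ∀ c t → zigzag c (t + t) ≡ t + c
zigzag-even c zero = refl
zigzag-even c (suc t) = begin
  zigzag c (suc t + suc t)    ≡⟨ cong (λ m → zigzag c (suc m)) (+-suc t t) ⟩
  zigzag (suc c) (t + t)      ≡⟨ zigzag-even (suc c) t ⟩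
  t + suc c                   ≡⟨ +-suc t c ⟩
  suc t + c                   ∎
  where open ≡-Reasoning

zigzag-odd : ∀ c t → zigzag c (suc (t + t)) ≡ 0
zigzag-odd c zero = refl
zigzag-odd c (suc t) = trans (cong (λ m → zigzag c (suc (suc m))) (+-suc t t)) (zigzag-odd (suc c) t)

letter-even : ∀ t → letter (t + t) ≡ suc t
letter-even t = trans (zigzag-even 1 t) (+-comm t 1)

letter-odd : ∀ t → letter (suc (t + t)) ≡ 0
letter-odd = zigzag-odd 1

letter-position : ∀ m t → letter m ≡ suc t → m ≡ t + t
letter-position m t eq with parity m
... | even s = cong (λ r → r + r) (suc-injective (trans (sym (letter-even s)) eq))
... | odd s  = ⊥-elim (0≢1+n (trans (sym (letter-odd s)) eq))

-- In 1-indexed positions, 2t+1 carries the unique letter t+1 and 2t+2 the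
-- repeated letter 0; the point SUSs are the k+1 letters at odd positions and
-- the 2k intervals [q,q+1], two around each even position.
module Tight (k : ℕ) (2≤k : 2 ≤ k) where

  n : ℕ
  n = suc (k + k)

  T : List ℕ
  T = applyUpTo letter n

  length-T : length T ≡ n
  length-T = length-applyUpTo letter n

  ≤n⇒≤|T| : ∀ {q} → q ≤ n → q ≤ length T
  ≤n⇒≤|T| {q} = subst (q ≤_) (sym length-T)

  ≤|T|⇒≤n : ∀ {q} → q ≤ length T → q ≤ n
  ≤|T|⇒≤n {q} = subst (q ≤_) length-T

  odd-pos even-pos : ℕ → ℕ
  odd-pos t = suc (t + t)
  even-pos t = suc (suc (t + t))

  letter-at : ∀ {q} → 1 ≤ q → q ≤ n → sub T q q ≡ letter (q ∸ 1) ∷ []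
  letter-at {suc q} _ q<n = begin
    take (suc (q ∸ q)) (drop q T) ≡⟨ cong (λ l → take (suc l) (drop q T)) (n∸n≡0 q) ⟩
    take 1 (drop q T)             ≡⟨ window-applyUpTo letter q<n ⟩
    letter q ∷ []                 ∎
    where open ≡-Reasoning

  occurs-at : ∀ {q} → 1 ≤ q → q ≤ n → OccursAt T (letter (q ∸ 1) ∷ []) q
  occurs-at 1≤q q≤n = 1≤q , window-applyUpTo letter (pred-below 1≤q q≤n)

  occurs-letter : ∀ {v q} → OccursAt T (v ∷ []) q → letter (q ∸ 1) ≡ v
  occurs-letter {q = q} (_ , window) = window-applyUpTo⁻ letter n (q ∸ 1) window

  odd-unique : ∀ t → odd-pos t ≤ n → UniqueInt T (odd-pos t) (odd-pos t)
  odd-unique t q≤n = subst (UniqueStr T) (sym (letter-at (s≤s z≤n) q≤n))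
    (odd-pos t , occurs-at (s≤s z≤n) q≤n , only)
    where
    only : ∀ q → OccursAt T (letter (t + t) ∷ []) q → q ≡ odd-pos t
    only (suc q) occ = cong suc (letter-position q t (trans (occurs-letter occ) (letter-even t)))

  even-repeating : ∀ t → even-pos t ≤ n → RepeatingInt T (even-pos t) (even-pos t)
  even-repeating t p≤n =
    subst (RepeatingStr T) (sym (trans (letter-at (s≤s z≤n) p≤n) (cong (_∷ []) (letter-odd t))))
      (2 , 4 , (λ ()) , occurs-at {2} (s≤s z≤n) (≤-trans (≤-trans (n≤1+n 2) (n≤1+n 3)) 4≤n) ,
                        occurs-at {4} (s≤s z≤n) 4≤n)
    where
    4≤n : 4 ≤ n
    4≤n = ≤-trans (+-mono-≤ 2≤k 2≤k) (n≤1+n (k + k))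

  odd-after-even : ∀ t → odd-pos (suc t) ≡ suc (even-pos t)
  odd-after-even t = cong (suc ∘ suc) (+-suc t t)

  even-pos-inner : ∀ t → even-pos t ≤ n → suc (even-pos t) ≤ n
  even-pos-inner t (s≤s 2t+1≤2k) = subst (_≤ n) (odd-after-even t) (s≤s (+-mono-≤ t<k t<k))
    where
    t<k : t < k
    t<k = double-cancel-< {t} {k} 2t+1≤2k

  -- Around an even position both length-two intervals are unique, as they contain an odd position.
  left-pair-unique : ∀ t → even-pos t ≤ n → UniqueInt T (odd-pos t) (even-pos t)
  left-pair-unique t p≤n =
    unique-extend T (odd-unique t (<⇒≤ p≤n)) (s≤s z≤n) ≤-refl ≤-refl (n≤1+n _) (≤n⇒≤|T| p≤n)

  right-pair-unique : ∀ t → even-pos t ≤ n → UniqueInt T (even-pos t) (suc (even-pos t))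
  right-pair-unique t p≤n =
    unique-extend T next-unique (s≤s z≤n) (n≤1+n _) ≤-refl ≤-refl (≤n⇒≤|T| p+1≤n)
    where
    p+1≤n : suc (even-pos t) ≤ n
    p+1≤n = even-pos-inner t p≤n
    next-unique : UniqueInt T (suc (even-pos t)) (suc (even-pos t))
    next-unique = subst (λ q → UniqueInt T q q) (odd-after-even t)
                        (odd-unique (suc t) (subst (_≤ n) (sym (odd-after-even t)) p+1≤n))

  odd-sus : ∀ t → odd-pos t ≤ n → IsSUS T (odd-pos t) (odd-pos t) (odd-pos t) (odd-pos t)
  odd-sus t q≤n = unique-letter-sus T (s≤s z≤n) (≤n⇒≤|T| q≤n) (odd-unique t q≤n)

  odd-sus-only : ∀ t {i j} → IsSUS T (odd-pos t) (odd-pos t) i j → (i , j) ≡ (odd-pos t , odd-pos t)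
  odd-sus-only t sus@(_ , j≤|T| , _ , i≤q , q≤j , _) =
    sus-forced T sus (odd-unique t (≤-trans q≤j (≤|T|⇒≤n j≤|T|))) i≤q ≤-refl ≤-refl q≤j

  left-pair-sus : ∀ t → even-pos t ≤ n → IsSUS T (even-pos t) (even-pos t) (odd-pos t) (even-pos t)
  left-pair-sus t p≤n = length-two-sus T (even-repeating t p≤n) (left-pair-unique t p≤n) (s≤s z≤n) (≤n⇒≤|T| p≤n)
                          (n≤1+n _) ≤-refl (m+n∸n≡m 1 (odd-pos t))

  right-pair-sus : ∀ t → even-pos t ≤ n → IsSUS T (even-pos t) (even-pos t) (even-pos t) (suc (even-pos t))
  right-pair-sus t p≤n = length-two-sus T (even-repeating t p≤n) (right-pair-unique t p≤n) (s≤s z≤n)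
                           (≤n⇒≤|T| (even-pos-inner t p≤n)) ≤-refl (n≤1+n _) (m+n∸n≡m 1 (even-pos t))

  even-sus-only : ∀ t {i j} → IsSUS T (even-pos t) (even-pos t) i j →
                  (i , j) ≡ (odd-pos t , even-pos t) ⊎ (i , j) ≡ (even-pos t , suc (even-pos t))
  even-sus-only t {i} {j} sus@(_ , j≤|T| , U , i≤p , p≤j , _) with i <? even-pos t | even-pos t <? j
  ... | yes i<p | _ = inj₁ (sus-forced T sus (left-pair-unique t p≤n) (≤-pred i<p) (n≤1+n _) ≤-refl p≤j)
    where
    p≤n : even-pos t ≤ n
    p≤n = ≤-trans p≤j (≤|T|⇒≤n j≤|T|)
  ... | no i≮p | yes p<j with refl ← ≤-antisym i≤p (≮⇒≥ i≮p) =
    inj₂ (sus-forced T sus (right-pair-unique t (≤-trans p≤j j≤n)) ≤-refl ≤-refl (n≤1+n _) p<j)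
    where
    j≤n : j ≤ n
    j≤n = ≤|T|⇒≤n j≤|T|
  ... | no i≮p | no p≮j with refl ← ≤-antisym i≤p (≮⇒≥ i≮p) | refl ← ≤-antisym p≤j (≮⇒≥ p≮j) =
    ⊥-elim (unique-not-repeating {i = i} {i} U (even-repeating t (≤|T|⇒≤n j≤|T|)))

  pair single : ℕ → Interval
  pair q = suc q , suc (suc q)
  single t = odd-pos t , odd-pos t

  pairs singles L : List Interval
  pairs = map pair (upTo (k + k))
  singles = map single (upTo (suc k))
  L = pairs ++ singles

  pair-sus : ∀ q → q < k + k → PointSUS T (pair q)
  pair-sus q q<2k with parity q
  ... | even t = even-pos t , s≤s z≤n , ≤n⇒≤|T| (s≤s q<2k) , left-pair-sus t (s≤s q<2k)
  ... | odd t  = even-pos t , s≤s z≤n , ≤n⇒≤|T| (<⇒≤ (s≤s q<2k)) , right-pair-sus t (<⇒≤ (s≤s q<2k))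

  single-sus : ∀ t → t < suc k → PointSUS T (single t)
  single-sus t (s≤s t≤k) = odd-pos t , s≤s z≤n , ≤n⇒≤|T| q≤n , odd-sus t q≤n
    where
    q≤n : odd-pos t ≤ n
    q≤n = s≤s (+-mono-≤ t≤k t≤k)

  listed⇒sus : ∀ x → x ∈ L → PointSUS T x
  listed⇒sus x x∈L with ∈-++⁻ pairs x∈L
  ... | inj₁ x∈pairs   with q , q∈ , refl ← ∈-map⁻ pair {xs = upTo (k + k)} x∈pairs = pair-sus q (∈-upTo⁻ q∈)
  ... | inj₂ x∈singles with t , t∈ , refl ← ∈-map⁻ single {xs = upTo (suc k)} x∈singles = single-sus t (∈-upTo⁻ t∈)

  sus⇒listed : ∀ x → PointSUS T x → x ∈ L
  sus⇒listed _ (suc m , _ , p≤|T| , sus) with parity m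
  ... | even t with refl ← odd-sus-only t sus =
    ∈-++⁺ʳ pairs (∈-map⁺ single (∈-upTo⁺ (s≤s (double-cancel-≤ {t} {k} (≤-pred (≤|T|⇒≤n p≤|T|))))))
  ... | odd t with even-sus-only t sus
  ...   | inj₁ refl = ∈-++⁺ˡ (∈-map⁺ pair (∈-upTo⁺ (≤-pred (≤|T|⇒≤n p≤|T|))))
  ...   | inj₂ refl = ∈-++⁺ˡ (∈-map⁺ pair (∈-upTo⁺ (≤-pred (even-pos-inner t (≤|T|⇒≤n p≤|T|)))))

  distinct-L : Unique L
  distinct-L = Unique.++⁺ (Unique.map⁺ (suc-injective ∘ cong proj₁) (Unique.upTo⁺ (k + k)))
                          (Unique.map⁺ single-injective (Unique.upTo⁺ (suc k)))
                          pair≢single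
    where
    single-injective : ∀ {t t′} → single t ≡ single t′ → t ≡ t′
    single-injective {t} {t′} = double-injective {t} {t′} ∘ suc-injective ∘ cong proj₁
    -- A pair has length two, a single letter length one.
    pair≢single : ∀ {v} → ¬ (v ∈ pairs × v ∈ singles)
    pair≢single (v∈pairs , v∈singles)
      with _ , _ , refl ← ∈-map⁻ pair {xs = upTo (k + k)} v∈pairs
         | _ , _ , eq ← ∈-map⁻ single {xs = upTo (suc k)} v∈singles =
      1+n≢n (trans (cong proj₂ eq) (sym (cong proj₁ eq)))

  length-L : 2 * length L ≡ 3 * n ∸ 1
  length-L = begin
    2 * length (pairs ++ singles)          ≡⟨ cong (2 *_) (length-++ pairs) ⟩
    2 * (length pairs + length singles)    ≡⟨ cong (λ l → 2 * (l + length singles)) (length-map pair (upTo (k + k))) ⟩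
    2 * (length (upTo (k + k)) + length singles)
                                          ≡⟨ cong₂ (λ a b → 2 * (a + b)) (length-upTo (k + k))
                                                  (trans (length-map single (upTo (suc k))) (length-upTo (suc k))) ⟩
    2 * (k + k + suc k)                    ≡⟨ three-halves k ⟩
    3 * n ∸ 1                              ∎
    where
    open ≡-Reasoning
    -- 3 * n ∸ 1 computes to k + k + 2 * suc (k + k).
    three-halves : ∀ k → 2 * (k + k + suc k) ≡ k + k + 2 * suc (k + k)
    three-halves = solve-∀

TightWitness : ℕ → Set
TightWitness n = Σ (List ℕ) λ T → (length T ≡ n) ×
                   Σ (List Interval) λ L → Unique L ×
                     ((x : Interval) → (x ∈ L) ⇔ PointSUS T x) ×
                     (2 * length L ≡ 3 * n ∸ 1)

tight-example : (n : ℕ) → 5 ≤ n → Odd n → TightWitness n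
tight-example n 5≤n (k , n≡1+2k) = subst TightWitness (sym n≡2k+1)
  (T , length-T , L , distinct-L , (λ x → mk⇔ (listed⇒sus x) (sus⇒listed x)) , length-L)
  where
  n≡2k+1 : n ≡ suc (k + k)
  n≡2k+1 = trans n≡1+2k (cong (λ m → suc (k + m)) (+-identityʳ k))
  open Tight k (double-cancel-≤ {2} {k} (≤-pred (subst (5 ≤_) n≡2k+1 5≤n)))

theorem3 :
    ((A : Set) (S : List A) → 1 ≤ length S →
       (L : List Interval) → Unique L → All (PointSUS S) L →
       2 * length L ≤ 3 * length S ∸ 1)
    ×
    ((n : ℕ) → 5 ≤ n → Odd n →
       Σ (List ℕ) λ T → (length T ≡ n) ×
         Σ (List Interval) λ L → Unique L ×
           ((x : Interval) → (x ∈ L) ⇔ PointSUS T x) ×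
           (2 * length L ≡ 3 * n ∸ 1))
theorem3 = point-sus-upper-bound , tight-example
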